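{- Let $\Sigma$ be a finite alphabet of size $q$ and let $\mathcal{X},\mathcal{Y}\subseteq\Sigma^{m}$. If $\mathcal{X}$ and $\mathcal{Y}$ are both prefix thick (with degree $q/2$), then $\mathcal{X}\cap\mathcal{Y}\neq\emptyset$.
   Context: The prefix tree of a non-empty set $\mathcal{X}\subseteq\Sigma^m$ is the rooted tree of depth $m$ whose vertices at depth $i$ are the length-$i$ prefixes of strings in $\mathcal{X}$ (root: the empty string; leaves: the strings of $\mathcal{X}$), where a vertex $y$ at depth $i+1$ is a child of $x$ at depth $i$ iff $x$ is a prefix of $y$. A set $\mathcal{X}\subseteq\Sigma^m$ is prefix thick with degree $t$ if there is a non-empty subset $\mathcal{X}'\subseteq\mathcal{X}$ whose prefix tree has minimum degree greater than $t$, i.e., every vertex at depth less than $m$ has more than $t$ children. -}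

module Defs where

open import Data.Nat using (ℕ; _<_; _*_)
open import Data.Fin using (Fin)
open import Data.List using (List; length; _++_; _∷ʳ_)
open import Data.List.Relation.Unary.All using (All)
open import Data.List.Relation.Unary.Unique.Propositional using (Unique)
open import Data.Vec using (Vec; toList)
open import Data.Product using (Σ; ∃; _×_)
open import Relation.Binary.PropositionalEquality using (_≡_)

-- Alphabet Σ = Fin q; strings of length m are Vec (Fin q) m;
-- a set 𝒳 ⊆ Σ^m is a predicate on Vec (Fin q) m.
Word : ℕ → ℕ → Set
Word q m = Vec (Fin q) m

Lang : ℕ → ℕ → Set₁
Lang q m = Word q m → Set

IsPrefix : ∀ {A : Set} → List A → List A → Set
IsPrefix {A} x y = Σ (List A) λ z → x ++ z ≡ y

-- x is a vertex of the prefix tree of 𝒳 (a prefix of some string in 𝒳)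
Vertex : ∀ {q m} → Lang q m → List (Fin q) → Set
Vertex {q} {m} 𝒳 x = Σ (Word q m) λ y → 𝒳 y × IsPrefix x (toList y)

_⊆_ : ∀ {q m} → Lang q m → Lang q m → Set
X ⊆ Y = ∀ w → X w → Y w

NonEmpty : ∀ {q m} → Lang q m → Set
NonEmpty {q} {m} X = Σ (Word q m) X

-- "x has more than q/2 children in the prefix tree of 𝒳":
-- there are k distinct letters a with x ∷ʳ a a vertex, and k > q/2 (i.e. q < 2k).
MoreThanHalfChildren : ∀ {q m} → Lang q m → List (Fin q) → Set
MoreThanHalfChildren {q} 𝒳 x =
  Σ (List (Fin q)) λ as → Unique as × All (λ a → Vertex 𝒳 (x ∷ʳ a)) as × q < 2 * length as

MinDegreeGtHalf : ∀ {q m} → Lang q m → Set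
MinDegreeGtHalf {q} {m} 𝒳 =
  ∀ (x : List (Fin q)) → length x < m → Vertex 𝒳 x → MoreThanHalfChildren 𝒳 x

PrefixThickHalf : ∀ {q m} → Lang q m → Set₁
PrefixThickHalf {q} {m} 𝒳 =
  Σ (Lang q m) λ 𝒳' → 𝒳' ⊆ 𝒳 × NonEmpty 𝒳' × MinDegreeGtHalf 𝒳'

{-# OPTIONS --safe #-}
module Submission where

-- Walk down from the root through vertices common to the two thick subtrees.
-- At a common vertex each subtree has more than q/2 children among only q
-- letters, so by pigeonhole some child is common to both; after m steps the
-- common vertex is a leaf, i.e. a word of both sets.

open import Defs
open import Data.Nat using (ℕ; zero; suc; _+_; _*_; _≤_; _<_; s≤s; z≤n)
open import Data.Nat.Properties
  using (*-cancelˡ-<; +-mono-<; *-distribˡ-+; +-identityʳ; +-assoc; m<m+n; <⇒≱; suc-injective; module ≤-Reasoning)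
open import Data.Product using (Σ; _×_; _,_)
open import Data.Fin using (Fin)
open import Data.Fin.Properties using (injective⇒≤) renaming (_≟_ to _≟ᶠ_)
open import Data.List using (List; []; _∷_; length; _++_; _∷ʳ_; lookup)
open import Data.List.Properties using (∷-injectiveˡ; ∷-injectiveʳ; length-++)
open import Data.List.Relation.Unary.All as All using (All)
open import Data.List.Relation.Unary.Any using (any?)
open import Data.List.Relation.Unary.AllPairs using (_∷_)
open import Data.List.Relation.Unary.Unique.Propositional using (Unique)
open import Data.List.Relation.Unary.Unique.Propositional.Properties using (++⁺)
open import Data.List.Membership.Propositional using (_∈_; find; lose)
open import Data.List.Membership.Propositional.Properties using (∈-lookup)
import Data.List.Membership.DecPropositional as DecMembership
open import Data.Vec using (toList)
open import Data.Vec.Properties using (toList-injective; length-toList; cast-is-id)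
open import Relation.Nullary using (yes; no; ¬_; contradiction)
open import Relation.Binary.PropositionalEquality
  using (_≡_; refl; sym; trans; cong; cong₂; subst)

Unique⇒lookup-injective : ∀ {A : Set} {xs : List A} → Unique xs →
  ∀ i j → lookup xs i ≡ lookup xs j → i ≡ j
Unique⇒lookup-injective (_ ∷ _) Fin.zero Fin.zero _ = refl
Unique⇒lookup-injective (x∉ ∷ _) Fin.zero (Fin.suc j) eq = contradiction eq (All.lookup x∉ (∈-lookup j))
Unique⇒lookup-injective (x∉ ∷ _) (Fin.suc i) Fin.zero eq = contradiction (sym eq) (All.lookup x∉ (∈-lookup i))
Unique⇒lookup-injective (_ ∷ u) (Fin.suc i) (Fin.suc j) eq = cong Fin.suc (Unique⇒lookup-injective u i j eq)

Unique⇒length≤ : ∀ {q} {as : List (Fin q)} → Unique as → length as ≤ q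
Unique⇒length≤ {as = as} u = injective⇒≤ {f = lookup as} (Unique⇒lookup-injective u _ _)

module _ {q : ℕ} where
  open DecMembership (_≟ᶠ_ {q}) using (_∈?_)

  Unique-long-lists-intersect : (as bs : List (Fin q)) → Unique as → Unique bs →
    q < length as + length bs → Σ (Fin q) λ a → a ∈ as × a ∈ bs
  Unique-long-lists-intersect as bs uas ubs q<|as|+|bs| with any? (_∈? bs) as
  ... | yes some∈bs = find some∈bs
  ... | no none∈bs = contradiction |as++bs|≤q (<⇒≱ q<|as++bs|)
    where
    disjoint : ∀ {a} → ¬ (a ∈ as × a ∈ bs)
    disjoint (a∈as , a∈bs) = none∈bs (lose a∈as a∈bs)

    |as++bs|≤q : length (as ++ bs) ≤ q
    |as++bs|≤q = Unique⇒length≤ (++⁺ uas ubs disjoint)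

    q<|as++bs| : q < length (as ++ bs)
    q<|as++bs| = subst (q <_) (sym (length-++ as)) q<|as|+|bs|

more-than-halves-exceed : ∀ q a b → q < 2 * a → q < 2 * b → q < a + b
more-than-halves-exceed q a b q<2a q<2b = *-cancelˡ-< 2 q (a + b) (begin-strict
    2 * q         ≡⟨ cong (q +_) (+-identityʳ q) ⟩
    q + q         <⟨ +-mono-< q<2a q<2b ⟩
    2 * a + 2 * b ≡⟨ sym (*-distribˡ-+ 2 a b) ⟩
    2 * (a + b)   ∎)
  where open ≤-Reasoning

IsPrefix-of-equal-length⇒≡ : ∀ {A : Set} {xs ys : List A} →
  IsPrefix xs ys → length xs ≡ length ys → xs ≡ ys
IsPrefix-of-equal-length⇒≡ {xs = []} {[]} _ _ = refl
IsPrefix-of-equal-length⇒≡ {xs = x ∷ xs} {y ∷ ys} (zs , x∷xs++zs≡y∷ys) |x∷xs|≡|y∷ys| =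
  cong₂ _∷_ (∷-injectiveˡ x∷xs++zs≡y∷ys)
    (IsPrefix-of-equal-length⇒≡ (zs , ∷-injectiveʳ x∷xs++zs≡y∷ys) (suc-injective |x∷xs|≡|y∷ys|))

module _ {q m : ℕ} where

  root-vertex : {𝒳 : Lang q m} → NonEmpty 𝒳 → Vertex 𝒳 []
  root-vertex (w , 𝒳w) = w , 𝒳w , toList w , refl

  leaf-vertex⇒word : {𝒳 : Lang q m} {x : List (Fin q)} → length x ≡ m →
    Vertex 𝒳 x → Σ (Word q m) λ w → 𝒳 w × toList w ≡ x
  leaf-vertex⇒word |x|≡m (w , 𝒳w , x⊑w) =
    w , 𝒳w , sym (IsPrefix-of-equal-length⇒≡ x⊑w (trans |x|≡m (sym (length-toList w))))

  common-leaf⇒common-word : {𝒳 𝒴 : Lang q m} {x : List (Fin q)} → length x ≡ m →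
    Vertex 𝒳 x → Vertex 𝒴 x → Σ (Word q m) λ w → 𝒳 w × 𝒴 w
  common-leaf⇒common-word {𝒴 = 𝒴} |x|≡m v𝒳 v𝒴
    with leaf-vertex⇒word |x|≡m v𝒳 | leaf-vertex⇒word |x|≡m v𝒴
  ... | w , 𝒳w , w≡x | w′ , 𝒴w′ , w′≡x =
    w , 𝒳w , subst 𝒴 w′≡w 𝒴w′
    where
    w′≡w : w′ ≡ w
    w′≡w = trans (sym (cast-is-id refl w′)) (toList-injective refl w′ w (trans w′≡x (sym w≡x)))

  common-child : {𝒳 𝒴 : Lang q m} → MinDegreeGtHalf 𝒳 → MinDegreeGtHalf 𝒴 →
    (x : List (Fin q)) → length x < m → Vertex 𝒳 x → Vertex 𝒴 x →
    Σ (Fin q) λ a → Vertex 𝒳 (x ∷ʳ a) × Vertex 𝒴 (x ∷ʳ a)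
  common-child δ𝒳 δ𝒴 x |x|<m v𝒳 v𝒴
    with δ𝒳 x |x|<m v𝒳 | δ𝒴 x |x|<m v𝒴
  ... | as , uas , children𝒳 , q<2|as| | bs , ubs , children𝒴 , q<2|bs|
    with Unique-long-lists-intersect as bs uas ubs
           (more-than-halves-exceed q (length as) (length bs) q<2|as| q<2|bs|)
  ... | a , a∈as , a∈bs = a , All.lookup children𝒳 a∈as , All.lookup children𝒴 a∈bs

  common-vertex⇒common-word : {𝒳 𝒴 : Lang q m} → MinDegreeGtHalf 𝒳 → MinDegreeGtHalf 𝒴 →
    (k : ℕ) (x : List (Fin q)) → length x + k ≡ m → Vertex 𝒳 x → Vertex 𝒴 x →
    Σ (Word q m) λ w → 𝒳 w × 𝒴 w
  common-vertex⇒common-word _ _ zero x |x|+0≡m =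
    common-leaf⇒common-word (trans (sym (+-identityʳ (length x))) |x|+0≡m)
  common-vertex⇒common-word δ𝒳 δ𝒴 (suc k) x |x|+1+k≡m v𝒳 v𝒴 =
    let a , v𝒳′ , v𝒴′ = common-child δ𝒳 δ𝒴 x |x|<m v𝒳 v𝒴
    in common-vertex⇒common-word δ𝒳 δ𝒴 k (x ∷ʳ a) (|x∷ʳa|+k≡m a) v𝒳′ v𝒴′
    where
    |x|<m : length x < m
    |x|<m = subst (length x <_) |x|+1+k≡m (m<m+n (length x) (s≤s z≤n))

    |x∷ʳa|+k≡m : ∀ a → length (x ∷ʳ a) + k ≡ m
    |x∷ʳa|+k≡m _ = trans (cong (_+ k) (length-++ x)) (trans (+-assoc (length x) 1 k) |x|+1+k≡m)

proposition1p10 : (q m : ℕ) (𝒳 𝒴 : Lang q m) →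
    PrefixThickHalf 𝒳 → PrefixThickHalf 𝒴 →
    Σ (Word q m) λ w → 𝒳 w × 𝒴 w
proposition1p10 q m 𝒳 𝒴 (𝒳′ , 𝒳′⊆𝒳 , ∃𝒳′ , δ𝒳′) (𝒴′ , 𝒴′⊆𝒴 , ∃𝒴′ , δ𝒴′)
  with common-vertex⇒common-word δ𝒳′ δ𝒴′ m [] refl (root-vertex ∃𝒳′) (root-vertex ∃𝒴′)
... | w , 𝒳′w , 𝒴′w = w , 𝒳′⊆𝒳 w 𝒳′w , 𝒴′⊆𝒴 w 𝒴′w
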